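{- If $n$ is a positive integer with $d(n) = 2$, then $n \equiv -1 \pmod 6$.
   Context: For a finite simple graph $G=(V,E)$, define $\Phi_G(S) = \{v \in V : \lvert N[v]\cap S\rvert \text{ odd}\}$ for $S \subseteq V$, where $N[v]$ is the closed neighborhood of $v$; this is $\mathbb{F}_2$-linear. $d(n)$ denotes $\dim_{\mathbb{F}_2}\ker\Phi_G$ where $G$ is the $n\times n$ grid graph (cells of an $n\times n$ array, adjacent when sharing a side). -}

module Defs where

open import Data.Nat using (ℕ; suc; _≡ᵇ_)
open import Data.Fin using (Fin; toℕ)
open import Data.Bool using (Bool; true; false; _∧_; _∨_; _xor_)
open import Data.List using (List; foldr; map; allFin)
open import Data.Product using (_×_; _,_; Σ)
open import Relation.Binary.PropositionalEquality using (_≡_)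

-- F₂ is represented by Bool (addition = xor, multiplication = ∧).

⊕ : {m : ℕ} → (Fin m → Bool) → Bool
⊕ {m} f = foldr _xor_ false (map f (allFin m))

Cell : ℕ → Set
Cell n = Fin n × Fin n

Vect : ℕ → Set
Vect n = Cell n → Bool

⊕Cell : {n : ℕ} → (Cell n → Bool) → Bool
⊕Cell f = ⊕ (λ i → ⊕ (λ j → f (i , j)))

differByOne : ℕ → ℕ → Bool
differByOne a b = (suc a ≡ᵇ b) ∨ (suc b ≡ᵇ a)

adjacent : {n : ℕ} → Cell n → Cell n → Bool
adjacent (i , j) (k , l) =
  ((toℕ i ≡ᵇ toℕ k) ∧ differByOne (toℕ j) (toℕ l))
  ∨ ((toℕ j ≡ᵇ toℕ l) ∧ differByOne (toℕ i) (toℕ k))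

inClosedNbhd : {n : ℕ} → Cell n → Cell n → Bool
inClosedNbhd (i , j) (k , l) =
  ((toℕ i ≡ᵇ toℕ k) ∧ (toℕ j ≡ᵇ toℕ l)) ∨ adjacent (i , j) (k , l)

Φ : {n : ℕ} → Vect n → Vect n
Φ S v = ⊕Cell (λ u → inClosedNbhd v u ∧ S u)

InKer : {n : ℕ} → Vect n → Set
InKer S = ∀ v → Φ S v ≡ false

lincomb : {n k : ℕ} → (Fin k → Vect n) → (Fin k → Bool) → Vect n
lincomb b c v = ⊕ (λ t → c t ∧ b t v)

IsKerBasis : (n k : ℕ) → (Fin k → Vect n) → Set
IsKerBasis n k b =
  (∀ t → InKer (b t))
  × (∀ (c : Fin k → Bool) → (∀ v → lincomb b c v ≡ false) → ∀ t → c t ≡ false)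
  × (∀ (S : Vect n) → InKer S → Σ (Fin k → Bool) (λ c → ∀ v → S v ≡ lincomb b c v))

-- d(n) = k : dim_{F₂} ker Φ_G = k for G the n×n grid (a basis of size k exists).
KerDim : ℕ → ℕ → Set
KerDim n k = Σ (Fin k → Vect n) (IsKerBasis n k)

{-# OPTIONS --safe #-}
module Submission where

open import Defs
open import Algebra.Bundles using (CommutativeRing)
open import Data.Bool using (Bool; true; false; _∧_; _∨_; _xor_)
import Data.Bool as Bool
open import Data.Bool.Properties using (xor-∧-commutativeRing; xor-identityʳ; xor-same; ∧-zeroʳ)
open import Data.Empty using (⊥; ⊥-elim)
open import Data.Fin using (Fin; toℕ; fromℕ<; inject≤; inject₁) renaming (zero to fzero; suc to fsuc)
open import Data.Fin.Patterns using (0F; 1F; 2F; 3F)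
open import Data.Fin.Properties using (toℕ-fromℕ<; toℕ<n; toℕ-inject≤; toℕ-inject₁; all?)
open import Data.List using (foldr; tabulate)
open import Data.List.Properties using (map-tabulate)
open import Data.Maybe using (just; nothing)
open import Data.Nat using (ℕ; zero; suc; _+_; _*_; _≤_; _<_; _%_; _≡ᵇ_; _≟_; z≤n; s≤s; NonZero)
open import Data.Nat.DivMod using (_/_; m≡m%n+[m/n]*n; m%n<n; m%n≤m; m∣n⇒o%n%m≡o%m; [m+kn]%n≡m%n)
open import Data.Nat.Divisibility using (divides)
open import Data.Nat.GeneralisedArithmetic using (fold; fold-+)
open import Data.Nat.Properties using (≤-refl; ≤-trans; ≤-total; <⇒≤; n≤1+n; +-comm)
open import Data.Product using (_×_; _,_; Σ; ∃; proj₁; proj₂)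
open import Data.Sum using (_⊎_; inj₁; inj₂; [_,_])
open import Data.Vec using (Vec; _∷_; []; lookup)
open import Function using (_∘_; id)
open import Relation.Binary.PropositionalEquality
  using (_≡_; _≢_; _≗_; refl; sym; trans; cong; cong₂; subst; module ≡-Reasoning)
open import Relation.Nullary using (¬_)
open import Relation.Nullary.Decidable using (decidable-stable; from-yes)
open import Tactic.RingSolver using (solve-∀)
open import Tactic.RingSolver.Core.AlmostCommutativeRing using (AlmostCommutativeRing; fromCommutativeRing)

open CommutativeRing xor-∧-commutativeRing using (+-commutativeMonoid; semiring)
open import Algebra.Properties.CommutativeMonoid.Sum +-commutativeMonoid
  using (sum; ∑-distrib-+; ∑-comm; sum-cong-≗; sum-replicate-zero)
open import Algebra.Properties.Semiring.Sum semiring using (*-distribˡ-sum)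

-- Write Φ = H + V + 1, where H (resp. V) applies the closed-neighbourhood operator N of the
-- n-vertex path to every row (resp. column) of the grid. H and V commute, so H preserves the
-- kernel K of Φ, on which V = H + 1; transposition also preserves K and swaps H and V.
-- If dim K = 2, the 2 × 2 matrix of H on K over 𝔽₂ is singular, fixes a nonzero vector, or
-- satisfies M² + M + 1 = 0. In the first two cases (after transposing in the second) some
-- nonzero S ∈ K has H S = 0 and hence V S = S: its rows lie in ker N and its columns in
-- ker A = ker (N + 1). Solving these recurrences along the path gives n ≡ 2 (mod 3) and n odd.
-- In the third case the rows of a basis vector lie in ker (A² + A + 1), which forces
-- n ≡ 4 (mod 5); but then three kernel vectors of the 4 × 4 grid, reflected across zero lines,
-- give three independent kernel vectors of the n × n grid.

𝔽₂ : AlmostCommutativeRing _ _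
𝔽₂ = fromCommutativeRing xor-∧-commutativeRing λ { false → just refl ; true → nothing }

private
  xor-left-comm : ∀ a b c → a xor (b xor c) ≡ b xor (a xor c)
  xor-left-comm = solve-∀ 𝔽₂

  xor-reverse : ∀ a b c → a xor (b xor c) ≡ c xor (b xor a)
  xor-reverse = solve-∀ 𝔽₂

  xor-swap-false : ∀ a b → a xor b ≡ b xor (a xor false)
  xor-swap-false = solve-∀ 𝔽₂

  xor-absorb : ∀ a b → a xor (a xor b) ≡ b
  xor-absorb = solve-∀ 𝔽₂

  xor-peel : ∀ a b x → x ≡ a xor (b xor (a xor (b xor x)))
  xor-peel = solve-∀ 𝔽₂

  xor-isolate : ∀ a b x {c} → a xor (b xor x) ≡ c → x ≡ a xor (b xor c)
  xor-isolate a b x refl = xor-peel a b x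

  xor-cancel : ∀ a b c → b ≡ (a xor c) xor (a xor (b xor c))
  xor-cancel = solve-∀ 𝔽₂

  xor-isolate-middle : ∀ a b c → a xor (b xor c) ≡ false → b ≡ a xor c
  xor-isolate-middle a b c eq =
    trans (xor-cancel a b c) (trans (cong ((a xor c) xor_) eq) (xor-identityʳ (a xor c)))

-- Sums over 𝔽₂

⊕≡sum : ∀ {m} (f : Fin m → Bool) → ⊕ f ≡ sum f
⊕≡sum f = trans (cong (foldr _xor_ false) (map-tabulate id f)) (foldr-tabulate f)
  where
  foldr-tabulate : ∀ {m} (f : Fin m → Bool) → foldr _xor_ false (tabulate f) ≡ sum f
  foldr-tabulate {zero} f = refl
  foldr-tabulate {suc m} f = cong (f fzero xor_) (foldr-tabulate (f ∘ fsuc))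

sum-select : ∀ {m} (i : Fin m) (f : Fin m → Bool) → sum (λ k → (toℕ i ≡ᵇ toℕ k) ∧ f k) ≡ f i
sum-select {suc m} fzero f = trans (cong (f fzero xor_) (sum-replicate-zero m)) (xor-identityʳ (f fzero))
sum-select (fsuc i) f = sum-select i (f ∘ fsuc)

sum-select₂ : ∀ {m m'} (i : Fin m) (F : Fin m → Fin m' → Bool) →
  sum (λ k → sum (λ l → (toℕ i ≡ᵇ toℕ k) ∧ F k l)) ≡ sum (F i)
sum-select₂ i F = trans (sum-cong-≗ λ k → sym (*-distribˡ-sum _ (F k))) (sum-select i (λ k → sum (F k)))

sum-linear : ∀ {m} x y (f g : Fin m → Bool) →
  sum (λ k → (x ∧ f k) xor (y ∧ g k)) ≡ (x ∧ sum f) xor (y ∧ sum g)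
sum-linear x y f g = trans (∑-distrib-+ (λ k → x ∧ f k) (λ k → y ∧ g k))
  (sym (cong₂ _xor_ (*-distribˡ-sum x f) (*-distribˡ-sum y g)))

sum-xor₃ : ∀ {m} (f g h : Fin m → Bool) → sum (λ k → f k xor (g k xor h k)) ≡ sum f xor (sum g xor sum h)
sum-xor₃ f g h = trans (∑-distrib-+ f (λ k → g k xor h k)) (cong (sum f xor_) (∑-distrib-+ g h))

-- The path: sequences on ℕ and zero padding

before : {A : Set} → A → (ℕ → A) → ℕ → A
before o g zero = o
before o g (suc k) = g k

pathN : (ℕ → Bool) → ℕ → Bool
pathN g k = before false g k xor (g k xor g (suc k))

pathN-local : ∀ {g g'} J → (∀ k → k ≤ suc J → g k ≡ g' k) → pathN g J ≡ pathN g' J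
pathN-local zero g≡g' = cong₂ _xor_ (g≡g' 0 z≤n) (g≡g' 1 ≤-refl)
pathN-local (suc J) g≡g' = cong₂ _xor_ (g≡g' J (≤-trans (n≤1+n J) (n≤1+n (suc J))))
  (cong₂ _xor_ (g≡g' (suc J) (n≤1+n (suc J))) (g≡g' (suc (suc J)) ≤-refl))

pathN-solve : ∀ g k {c} → pathN g k ≡ c → g (suc k) ≡ before false g k xor (g k xor c)
pathN-solve g k = xor-isolate (before false g k) (g k) (g (suc k))

pad : ∀ {m} → (Fin m → Bool) → ℕ → Bool
pad {zero} f k = false
pad {suc m} f zero = f fzero
pad {suc m} f (suc k) = pad (f ∘ fsuc) k

pad-toℕ : ∀ {m} (f : Fin m → Bool) (j : Fin m) → pad f (toℕ j) ≡ f j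
pad-toℕ f fzero = refl
pad-toℕ f (fsuc j) = pad-toℕ (f ∘ fsuc) j

pad-vanishes : ∀ {m} (f : Fin m → Bool) {k} → m ≤ k → pad f k ≡ false
pad-vanishes {zero} f _ = refl
pad-vanishes {suc m} f (s≤s m≤k) = pad-vanishes (f ∘ fsuc) m≤k

pad-restrict : ∀ {n} (s : ℕ → Bool) → s n ≡ false → ∀ {k} → k ≤ n → pad {n} (s ∘ toℕ) k ≡ s k
pad-restrict {zero} s s₀≡false z≤n = sym s₀≡false
pad-restrict {suc n} s _ {zero} _ = refl
pad-restrict {suc n} s sn≡false (s≤s k≤n) = pad-restrict (s ∘ suc) sn≡false k≤n

pad-cong : ∀ {m} {f g : Fin m → Bool} → (∀ k → f k ≡ g k) → ∀ x → pad f x ≡ pad g x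
pad-cong {zero} f≗g x = refl
pad-cong {suc m} f≗g zero = f≗g fzero
pad-cong {suc m} f≗g (suc x) = pad-cong (f≗g ∘ fsuc) x

pad-false : ∀ {m} x → pad {m} (λ _ → false) x ≡ false
pad-false {zero} x = refl
pad-false {suc m} zero = refl
pad-false {suc m} (suc x) = pad-false {m} x

pad-xor : ∀ {m} (f g : Fin m → Bool) x → pad (λ k → f k xor g k) x ≡ pad f x xor pad g x
pad-xor {zero} f g x = refl
pad-xor {suc m} f g zero = refl
pad-xor {suc m} f g (suc x) = pad-xor (f ∘ fsuc) (g ∘ fsuc) x

pad-swap : ∀ {m m'} (G : Fin m → Fin m' → Bool) x y →
  pad (λ k → pad (G k) y) x ≡ pad (λ l → pad (λ k → G k l) x) y
pad-swap {zero} {m'} G x y = sym (pad-false {m'} y)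
pad-swap {suc m} G zero y = refl
pad-swap {suc m} G (suc x) y = pad-swap (G ∘ fsuc) x y

pad-pathN : ∀ {m} (G : Fin m → ℕ → Bool) L x →
  pad (λ k → pathN (G k) L) x ≡ pathN (λ y → pad (λ k → G k y) x) L
pad-pathN {m} G L x = begin
  pad (λ k → before false (G k) L xor (G k L xor G k (suc L))) x
    ≡⟨ pad-xor (λ k → before false (G k) L) (λ k → G k L xor G k (suc L)) x ⟩
  pad (λ k → before false (G k) L) x xor pad (λ k → G k L xor G k (suc L)) x
    ≡⟨ cong₂ _xor_ (pad-before L) (pad-xor (λ k → G k L) (λ k → G k (suc L)) x) ⟩
  pathN (λ y → pad (λ k → G k y) x) L ∎
  where
  open ≡-Reasoning
  pad-before : ∀ L → pad (λ k → before false (G k) L) x ≡ before false (λ y → pad (λ k → G k y) x) L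
  pad-before zero = pad-false {m} x
  pad-before (suc L) = refl

pathNᶠ : ∀ {m} → (Fin m → Bool) → Fin m → Bool
pathNᶠ f l = pathN (pad f) (toℕ l)

pathNbhd : ℕ → ℕ → Bool
pathNbhd a b = (a ≡ᵇ b) ∨ differByOne a b

sum-pathNbhd : ∀ {m} (f : Fin m → Bool) a → sum (λ l → pathNbhd a (toℕ l) ∧ f l) ≡ pathN (pad f) a
sum-pathNbhd {zero} f zero = refl
sum-pathNbhd {zero} f (suc a) = refl
sum-pathNbhd {suc m} f zero = cong (f fzero xor_) (first m (f ∘ fsuc))
  where
  first : ∀ m (g : Fin m → Bool) → sum (λ l → ((0 ≡ᵇ toℕ l) ∨ false) ∧ g l) ≡ pad g 0
  first zero g = refl
  first (suc m) g = trans (cong (g fzero xor_) (sum-replicate-zero m)) (xor-identityʳ (g fzero))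
sum-pathNbhd {suc m} f 1 = cong (f fzero xor_) (sum-pathNbhd (f ∘ fsuc) 0)
sum-pathNbhd {suc m} f (suc (suc a)) = sum-pathNbhd (f ∘ fsuc) (suc a)

∀-below : ∀ {n} {P : ℕ → Set} → (∀ (j : Fin n) → P (toℕ j)) → ∀ k → k < n → P k
∀-below {P = P} all k k<n = subst P (toℕ-fromℕ< k<n) (all (fromℕ< k<n))

-- The grid operators H and V, and the kernel

≡ᵇ∧differByOne : ∀ a b → (a ≡ᵇ b) ∧ differByOne a b ≡ false
≡ᵇ∧differByOne zero zero = refl
≡ᵇ∧differByOne zero (suc b) = refl
≡ᵇ∧differByOne (suc a) zero = refl
≡ᵇ∧differByOne (suc a) (suc b) = ≡ᵇ∧differByOne a b

closedNbhd-split : ∀ e₁ e₂ d₁ d₂ x → e₁ ∧ d₁ ≡ false → e₂ ∧ d₂ ≡ false →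
  ((e₁ ∧ e₂) ∨ ((e₁ ∧ d₂) ∨ (e₂ ∧ d₁))) ∧ x
    ≡ (e₁ ∧ ((e₂ ∨ d₂) ∧ x)) xor ((e₂ ∧ ((e₁ ∨ d₁) ∧ x)) xor (e₁ ∧ (e₂ ∧ x)))
closedNbhd-split false false _ _ _ _ _ = refl
closedNbhd-split true false .false false x refl _ = refl
closedNbhd-split true false .false true x refl _ = sym (xor-identityʳ x)
closedNbhd-split false true d₁ .false x _ refl = sym (xor-identityʳ (d₁ ∧ x))
closedNbhd-split true true .false .false false refl refl = refl
closedNbhd-split true true .false .false true refl refl = refl

module _ {n : ℕ} where

  𝟘 : Vect n
  𝟘 _ = false

  infixl 6 _+ᵛ_
  infixl 7 _·_

  _+ᵛ_ : Vect n → Vect n → Vect n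
  (S +ᵛ S') v = S v xor S' v

  _·_ : Bool → Vect n → Vect n
  (x · S) v = x ∧ S v

  Linear : (Vect n → Vect n) → Set
  Linear F = ∀ x S y S' → F (x · S +ᵛ y · S') ≗ x · F S +ᵛ y · F S'

  linear-𝟘 : ∀ {F} → Linear F → F 𝟘 ≗ 𝟘
  linear-𝟘 F-linear = F-linear false 𝟘 false 𝟘

  transpose : Vect n → Vect n
  transpose S (i , j) = S (j , i)

  rowwise colwise : (Fin n → Fin n → Bool) → Vect n → Vect n
  rowwise A S (i , j) = sum (λ l → A j l ∧ S (i , l))
  colwise A S (i , j) = sum (λ k → A i k ∧ S (k , j))

  private
    ∧-distrib-comb : ∀ a x s y s' → a ∧ ((x ∧ s) xor (y ∧ s')) ≡ (x ∧ (a ∧ s)) xor (y ∧ (a ∧ s'))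
    ∧-distrib-comb = solve-∀ 𝔽₂

    ∧-left-comm : ∀ a b s → a ∧ (b ∧ s) ≡ b ∧ (a ∧ s)
    ∧-left-comm = solve-∀ 𝔽₂

  rowwise-linear : ∀ A → Linear (rowwise A)
  rowwise-linear A x S y S' (i , j) =
    trans (sum-cong-≗ λ l → ∧-distrib-comb (A j l) x (S (i , l)) y (S' (i , l)))
      (sum-linear x y (λ l → A j l ∧ S (i , l)) (λ l → A j l ∧ S' (i , l)))

  colwise-linear : ∀ A → Linear (colwise A)
  colwise-linear A x S y S' (i , j) =
    trans (sum-cong-≗ λ k → ∧-distrib-comb (A i k) x (S (k , j)) y (S' (k , j)))
      (sum-linear x y (λ k → A i k ∧ S (k , j)) (λ k → A i k ∧ S' (k , j)))

  rowwise-cong : ∀ A {S S'} → S ≗ S' → rowwise A S ≗ rowwise A S'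
  rowwise-cong A S≗S' (i , j) = sum-cong-≗ λ l → cong (A j l ∧_) (S≗S' (i , l))

  rowwise-colwise-comm : ∀ A B S → rowwise A (colwise B S) ≗ colwise B (rowwise A S)
  rowwise-colwise-comm A B S (i , j) = begin
    sum (λ l → A j l ∧ sum (λ k → B i k ∧ S (k , l)))
      ≡⟨ sum-cong-≗ (λ l → *-distribˡ-sum (A j l) (λ k → B i k ∧ S (k , l))) ⟩
    sum (λ l → sum (λ k → A j l ∧ (B i k ∧ S (k , l))))
      ≡⟨ ∑-comm (λ l k → A j l ∧ (B i k ∧ S (k , l))) ⟩
    sum (λ k → sum (λ l → A j l ∧ (B i k ∧ S (k , l))))
      ≡⟨ sum-cong-≗ (λ k → sum-cong-≗ λ l → ∧-left-comm (A j l) (B i k) (S (k , l))) ⟩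
    sum (λ k → sum (λ l → B i k ∧ (A j l ∧ S (k , l))))
      ≡⟨ sum-cong-≗ (λ k → sym (*-distribˡ-sum (B i k) (λ l → A j l ∧ S (k , l)))) ⟩
    sum (λ k → B i k ∧ sum (λ l → A j l ∧ S (k , l))) ∎
    where open ≡-Reasoning

  pathMatrix : Fin n → Fin n → Bool
  pathMatrix j l = pathNbhd (toℕ j) (toℕ l)

  H V : Vect n → Vect n
  H = rowwise pathMatrix
  V = colwise pathMatrix

  H-row : ∀ S i j → H S (i , j) ≡ pathNᶠ (λ l → S (i , l)) j
  H-row S i j = sum-pathNbhd (λ l → S (i , l)) (toℕ j)

  V-column : ∀ S i j → V S (i , j) ≡ pathNᶠ (λ k → S (k , j)) i
  V-column S i j = sum-pathNbhd (λ k → S (k , j)) (toℕ i)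

  Φ-decomposition : ∀ S v → Φ S v ≡ H S v xor (V S v xor S v)
  Φ-decomposition S (i , j) = begin
    Φ S (i , j)
      ≡⟨ trans (⊕≡sum (λ k → ⊕ (N k))) (sum-cong-≗ λ k → ⊕≡sum (N k)) ⟩
    sum (λ k → sum (N k))
      ≡⟨ sum-cong-≗ (λ k → trans (sum-cong-≗ (split k)) (sum-xor₃ (T₁ k) (T₂ k) (T₃ k))) ⟩
    sum (λ k → sum (T₁ k) xor (sum (T₂ k) xor sum (T₃ k)))
      ≡⟨ sum-xor₃ (λ k → sum (T₁ k)) (λ k → sum (T₂ k)) (λ k → sum (T₃ k)) ⟩
    sum (λ k → sum (T₁ k)) xor (sum (λ k → sum (T₂ k)) xor sum (λ k → sum (T₃ k)))
      ≡⟨ cong₂ _xor_ (sum-select₂ i (λ k l → pathMatrix j l ∧ S (k , l)))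
           (cong₂ _xor_ (trans (∑-comm T₂) (sum-select₂ j (λ l k → pathMatrix i k ∧ S (k , l))))
                        (trans (sum-select₂ i (λ k l → e j l ∧ S (k , l))) (sum-select j (λ l → S (i , l))))) ⟩
    H S (i , j) xor (V S (i , j) xor S (i , j)) ∎
    where
    open ≡-Reasoning
    e : Fin n → Fin n → Bool
    e i k = toℕ i ≡ᵇ toℕ k
    N T₁ T₂ T₃ : Fin n → Fin n → Bool
    N k l = inClosedNbhd (i , j) (k , l) ∧ S (k , l)
    T₁ k l = e i k ∧ (pathMatrix j l ∧ S (k , l))
    T₂ k l = e j l ∧ (pathMatrix i k ∧ S (k , l))
    T₃ k l = e i k ∧ (e j l ∧ S (k , l))
    split : ∀ k l → N k l ≡ T₁ k l xor (T₂ k l xor T₃ k l)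
    split k l = closedNbhd-split (e i k) (e j l) (differByOne (toℕ i) (toℕ k)) (differByOne (toℕ j) (toℕ l))
      (S (k , l)) (≡ᵇ∧differByOne (toℕ i) (toℕ k)) (≡ᵇ∧differByOne (toℕ j) (toℕ l))

  Φ-linear : Linear Φ
  Φ-linear x S y S' v = begin
    Φ (x · S +ᵛ y · S') v
      ≡⟨ Φ-decomposition _ v ⟩
    H (x · S +ᵛ y · S') v xor (V (x · S +ᵛ y · S') v xor (x · S +ᵛ y · S') v)
      ≡⟨ cong₂ _xor_ (rowwise-linear pathMatrix x S y S' v)
                     (cong (_xor (x · S +ᵛ y · S') v) (colwise-linear pathMatrix x S y S' v)) ⟩
    (x · H S +ᵛ y · H S') v xor ((x · V S +ᵛ y · V S') v xor (x · S +ᵛ y · S') v)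
      ≡⟨ regroup x y (H S v) (H S' v) (V S v) (V S' v) (S v) (S' v) ⟩
    (x ∧ (H S v xor (V S v xor S v))) xor (y ∧ (H S' v xor (V S' v xor S' v)))
      ≡⟨ sym (cong₂ (λ a b → (x ∧ a) xor (y ∧ b)) (Φ-decomposition S v) (Φ-decomposition S' v)) ⟩
    (x · Φ S +ᵛ y · Φ S') v ∎
    where
    open ≡-Reasoning
    regroup : ∀ x y h h' w w' s s' →
      ((x ∧ h) xor (y ∧ h')) xor (((x ∧ w) xor (y ∧ w')) xor ((x ∧ s) xor (y ∧ s')))
        ≡ (x ∧ (h xor (w xor s))) xor (y ∧ (h' xor (w' xor s')))
    regroup = solve-∀ 𝔽₂

module _ {n : ℕ} where

  InKer-linear : ∀ x {S : Vect n} y {S'} → InKer S → InKer S' → InKer (x · S +ᵛ y · S')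
  InKer-linear x {S} y {S'} S∈K S'∈K v = trans (Φ-linear x S y S' v)
    (trans (cong₂ (λ a b → (x ∧ a) xor (y ∧ b)) (S∈K v) (S'∈K v))
           (cong₂ _xor_ (∧-zeroʳ x) (∧-zeroʳ y)))

  InKer-H : ∀ {S : Vect n} → InKer S → InKer (H S)
  InKer-H {S} S∈K v = begin
    Φ (H S) v                                  ≡⟨ Φ-decomposition (H S) v ⟩
    H (H S) v xor (V (H S) v xor H S v)        ≡⟨ cong (λ a → H (H S) v xor (a xor H S v))
                                                      (sym (rowwise-colwise-comm pathMatrix pathMatrix S v)) ⟩
    H (H S) v xor (H (V S) v xor H S v)        ≡⟨ sym (cong (H (H S) v xor_) (H-additive (V S) S v)) ⟩
    H (H S) v xor H (V S +ᵛ S) v               ≡⟨ sym (H-additive (H S) (V S +ᵛ S) v) ⟩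
    H (H S +ᵛ (V S +ᵛ S)) v                    ≡⟨ rowwise-cong pathMatrix (λ u → sym (Φ-decomposition S u)) v ⟩
    H (Φ S) v                                  ≡⟨ rowwise-cong pathMatrix S∈K v ⟩
    H 𝟘 v                                      ≡⟨ linear-𝟘 (rowwise-linear pathMatrix) v ⟩
    false                                      ∎
    where
    open ≡-Reasoning
    H-additive : ∀ S₁ S₂ → H (S₁ +ᵛ S₂) ≗ H S₁ +ᵛ H S₂
    H-additive S₁ S₂ = rowwise-linear pathMatrix true S₁ true S₂

  InKer-transpose : ∀ {S : Vect n} → InKer S → InKer (transpose S)
  InKer-transpose {S} S∈K (i , j) = begin
    Φ (transpose S) (i , j)                        ≡⟨ Φ-decomposition (transpose S) (i , j) ⟩
    V S (j , i) xor (H S (j , i) xor S (j , i))    ≡⟨ xor-left-comm (V S (j , i)) (H S (j , i)) (S (j , i)) ⟩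
    H S (j , i) xor (V S (j , i) xor S (j , i))    ≡⟨ sym (Φ-decomposition S (j , i)) ⟩
    Φ S (j , i)                                    ≡⟨ S∈K (j , i) ⟩
    false                                          ∎
    where open ≡-Reasoning

  V-on-kernel : ∀ {S : Vect n} → InKer S → ∀ v → V S v ≡ H S v xor S v
  V-on-kernel {S} S∈K v = xor-isolate-middle (H S v) (V S v) (S v) (trans (sym (Φ-decomposition S v)) (S∈K v))

-- Recurrences along the path

fold-fixed : ∀ {A : Set} {f : A → A} {x} → f x ≡ x → ∀ k → fold x f k ≡ x
fold-fixed fx≡x zero = refl
fold-fixed {f = f} fx≡x (suc k) = trans (cong f (fold-fixed fx≡x k)) fx≡x

fold-periodic : ∀ {A : Set} {f : A → A} {x} p → fold x f p ≡ x → ∀ q → fold x f (q * p) ≡ x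
fold-periodic p period zero = refl
fold-periodic {f = f} {x} p period (suc q) =
  trans (fold-+ x f p) (trans (cong (λ y → fold y f p) (fold-periodic p period q)) period)

fold-mod : ∀ {A : Set} {f : A → A} {x} p .{{_ : NonZero p}} → fold x f p ≡ x →
  ∀ k → fold x f k ≡ fold x f (k % p)
fold-mod {f = f} {x} p period k = begin
  fold x f k                                ≡⟨ cong (fold x f) (m≡m%n+[m/n]*n k p) ⟩
  fold x f (k % p + (k / p) * p)            ≡⟨ fold-+ x f (k % p) ⟩
  fold (fold x f ((k / p) * p)) f (k % p)   ≡⟨ cong (λ y → fold y f (k % p)) (fold-periodic p period (k / p)) ⟩
  fold x f (k % p)                          ∎
  where open ≡-Reasoning

-- A solution of g (k + 1) = step (g (k - 1)) (g k), with g (-1) = o, is determined by g 0: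
-- its windows (g (k - 1) , g k) run through the orbit of (o , g 0) under next.
module Recurrence {A : Set} (o : A) (step : A → A → A) where

  Solves : ℕ → (ℕ → A) → Set
  Solves n g = ∀ k → k < n → g (suc k) ≡ step (before o g k) (g k)

  next : A × A → A × A
  next (a , b) = b , step a b

  window-orbit : ∀ {n g} → Solves n g → ∀ k → k ≤ n → (before o g k , g k) ≡ fold (o , g 0) next k
  window-orbit sol zero _ = refl
  window-orbit {g = g} sol (suc k) k<n =
    trans (cong (g k ,_) (sol k k<n)) (cong next (window-orbit sol k (<⇒≤ k<n)))

  -- The last hypothesis is a finite check: the orbit of a nonzero initial value returns to o
  -- within a period only at the residue r₀.
  solution-vanishes : ∀ {n} p r₀ .{{_ : NonZero p}} →
    step o o ≡ o →
    (∀ x → fold (o , x) next p ≡ (o , x)) →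
    (∀ x r → r < p → proj₂ (fold (o , x) next r) ≡ o → x ≡ o ⊎ r ≡ r₀) →
    n % p ≢ r₀ → ∀ {g} → Solves n g → (∀ k → n ≤ k → g k ≡ o) → ∀ k → g k ≡ o
  solution-vanishes {n} p r₀ step-o period table n≢r₀ {g} sol g-vanishes k with ≤-total k n
  ... | inj₂ n≤k = g-vanishes k n≤k
  ... | inj₁ k≤n = begin
    g k                                     ≡⟨ cong proj₂ (window-orbit sol k k≤n) ⟩
    proj₂ (fold (o , g 0) next k)           ≡⟨ cong (λ x → proj₂ (fold (o , x) next k)) g₀≡o ⟩
    proj₂ (fold (o , o) next k)             ≡⟨ cong proj₂ (fold-fixed (cong (o ,_) step-o) k) ⟩
    o                                       ∎
    where
    open ≡-Reasoning
    end-vanishes : proj₂ (fold (o , g 0) next (n % p)) ≡ o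
    end-vanishes = trans (cong proj₂ (sym (trans (window-orbit sol n ≤-refl) (fold-mod p (period (g 0)) n))))
                         (g-vanishes n ≤-refl)
    g₀≡o : g 0 ≡ o
    g₀≡o with table (g 0) (n % p) (m%n<n n p) end-vanishes
    ... | inj₁ g₀≡o = g₀≡o
    ... | inj₂ n≡r₀ = ⊥-elim (n≢r₀ n≡r₀)

pathN-annihilates⇒0 : ∀ {n g} → n % 3 ≢ 2 → (∀ k → n ≤ k → g k ≡ false) →
  (∀ k → k < n → pathN g k ≡ false) → ∀ k → g k ≡ false
pathN-annihilates⇒0 {n} {g} n≢2 g-vanishes Ng≡0 = solution-vanishes 3 2 refl period table n≢2 solves g-vanishes
  where
  open Recurrence false _xor_
  period : ∀ x → fold (false , x) next 3 ≡ (false , x)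
  period false = refl
  period true = refl
  table : ∀ x r → r < 3 → proj₂ (fold (false , x) next r) ≡ false → x ≡ false ⊎ r ≡ 2
  table false _ _ _ = inj₁ refl
  table true 2 _ _ = inj₂ refl
  table true 0 _ ()
  table true 1 _ ()
  table true (suc (suc (suc _))) (s≤s (s≤s (s≤s ()))) _
  solves : Solves n g
  solves k k<n = trans (pathN-solve g k (Ng≡0 k k<n)) (cong (before false g k xor_) (xor-identityʳ (g k)))

pathN-fixes⇒0 : ∀ {n g} → n % 2 ≢ 1 → (∀ k → n ≤ k → g k ≡ false) →
  (∀ k → k < n → pathN g k ≡ g k) → ∀ k → g k ≡ false
pathN-fixes⇒0 {n} {g} n≢1 g-vanishes Ng≡g = solution-vanishes 2 1 refl period table n≢1 solves g-vanishes
  where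
  open Recurrence false (λ a _ → a)
  period : ∀ x → fold (false , x) next 2 ≡ (false , x)
  period false = refl
  period true = refl
  table : ∀ x r → r < 2 → proj₂ (fold (false , x) next r) ≡ false → x ≡ false ⊎ r ≡ 1
  table false _ _ _ = inj₁ refl
  table true 1 _ _ = inj₂ refl
  table true 0 _ ()
  table true (suc (suc _)) (s≤s (s≤s ())) _
  solves : Solves n g
  solves k k<n = trans (pathN-solve g k (Ng≡g k k<n))
    (trans (cong (before false g k xor_) (xor-same (g k))) (xor-identityʳ (before false g k)))

pathN²+pathN+1-annihilates⇒0 : ∀ {n g h} → n % 5 ≢ 4 →
  (∀ k → n ≤ k → g k ≡ false) → (∀ k → n ≤ k → h k ≡ false) →
  (∀ k → k < n → pathN g k ≡ h k) → (∀ k → k < n → pathN h k ≡ h k xor g k) →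
  ∀ k → g k ≡ false
pathN²+pathN+1-annihilates⇒0 {n} {g} {h} n≢4 g-vanishes h-vanishes Ng≡h Nh≡h+g k =
  cong proj₁ (solution-vanishes 5 4 refl period table n≢4 solves
                (λ k n≤k → cong₂ _,_ (g-vanishes k n≤k) (h-vanishes k n≤k)) k)
  where
  step : Bool × Bool → Bool × Bool → Bool × Bool
  step (g₋ , h₋) (g₀ , h₀) = g₋ xor (g₀ xor h₀) , h₋ xor g₀
  open Recurrence (false , false) step
  period : ∀ x → fold ((false , false) , x) next 5 ≡ ((false , false) , x)
  period (false , false) = refl
  period (false , true) = refl
  period (true , false) = refl
  period (true , true) = refl
  table : ∀ x r → r < 5 → proj₂ (fold ((false , false) , x) next r) ≡ (false , false) →
    x ≡ (false , false) ⊎ r ≡ 4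
  table (false , false) _ _ _ = inj₁ refl
  table _ 4 _ _ = inj₂ refl
  table (false , true) 0 _ ()
  table (true , false) 0 _ ()
  table (true , true) 0 _ ()
  table (false , true) 1 _ ()
  table (true , false) 1 _ ()
  table (true , true) 1 _ ()
  table (false , true) 2 _ ()
  table (true , false) 2 _ ()
  table (true , true) 2 _ ()
  table (false , true) 3 _ ()
  table (true , false) 3 _ ()
  table (true , true) 3 _ ()
  table _ (suc (suc (suc (suc (suc _))))) (s≤s (s≤s (s≤s (s≤s (s≤s ()))))) _
  before-pair : ∀ k → before (false , false) (λ k → g k , h k) k ≡ (before false g k , before false h k)
  before-pair zero = refl
  before-pair (suc k) = refl
  solves : Solves n (λ k → g k , h k)
  solves k k<n = trans
    (cong₂ _,_ (pathN-solve g k (Ng≡h k k<n))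
               (trans (pathN-solve h k (Nh≡h+g k k<n)) (cong (before false h k xor_) (xor-absorb (h k) (g k)))))
    (cong (λ w → step w (g k , h k)) (sym (before-pair k)))

%2≡1⇒%3≡2⇒%6≡5 : ∀ n → n % 2 ≡ 1 → n % 3 ≡ 2 → n % 6 ≡ 5
%2≡1⇒%3≡2⇒%6≡5 n n≡1 n≡2 = residue (n % 6) (m%n<n n 6)
  (trans (m∣n⇒o%n%m≡o%m 2 6 n (divides 3 refl)) n≡1)
  (trans (m∣n⇒o%n%m≡o%m 3 6 n (divides 2 refl)) n≡2)
  where
  residue : ∀ r → r < 6 → r % 2 ≡ 1 → r % 3 ≡ 2 → r ≡ 5
  residue 0 _ () _
  residue 1 _ _ ()
  residue 2 _ () _
  residue 3 _ _ ()
  residue 4 _ () _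
  residue 5 _ _ _ = refl
  residue (suc (suc (suc (suc (suc (suc _)))))) (s≤s (s≤s (s≤s (s≤s (s≤s (s≤s ())))))) _ _

module _ {n : ℕ} where

  H-annihilates⇒𝟘 : ∀ {S} → n % 3 ≢ 2 → H S ≗ 𝟘 → S ≗ 𝟘
  H-annihilates⇒𝟘 {S} n≢2 HS≡𝟘 (i , j) = trans (sym (pad-toℕ (λ l → S (i , l)) j))
    (pathN-annihilates⇒0 {n} n≢2 (λ k → pad-vanishes (λ l → S (i , l)))
      (∀-below (λ l → trans (sym (H-row S i l)) (HS≡𝟘 (i , l)))) (toℕ j))

  V-fixes⇒𝟘 : ∀ {S} → n % 2 ≢ 1 → V S ≗ S → S ≗ 𝟘
  V-fixes⇒𝟘 {S} n≢1 VS≡S (i , j) = trans (sym (pad-toℕ (λ k → S (k , j)) i))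
    (pathN-fixes⇒0 {n} n≢1 (λ k → pad-vanishes (λ k → S (k , j)))
      (∀-below (λ k → trans (sym (V-column S k j)) (trans (VS≡S (k , j)) (sym (pad-toℕ (λ k → S (k , j)) k)))))
      (toℕ i))

  H²+H+1-annihilates⇒𝟘 : ∀ {S} → n % 5 ≢ 4 → H (H S) ≗ H S +ᵛ S → S ≗ 𝟘
  H²+H+1-annihilates⇒𝟘 {S} n≢4 HHS≡HS+S (i , j) = trans (sym (pad-toℕ s j))
    (pathN²+pathN+1-annihilates⇒0 {n} n≢4 (λ k → pad-vanishes s) (λ k → pad-vanishes t)
      (∀-below (λ l → trans (sym (H-row S i l)) (sym (pad-toℕ t l))))
      (∀-below (λ l → trans (sym (H-row (H S) i l))
                        (trans (HHS≡HS+S (i , l)) (sym (cong₂ _xor_ (pad-toℕ t l) (pad-toℕ s l))))))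
      (toℕ j))
    where
    s t : Fin n → Bool
    s l = S (i , l)
    t l = H S (i , l)

  H-annihilates⇒n%6≡5 : ∀ {S} → InKer S → H S ≗ 𝟘 → ¬ S ≗ 𝟘 → n % 6 ≡ 5
  H-annihilates⇒n%6≡5 {S} S∈K HS≡𝟘 S≢𝟘 = %2≡1⇒%3≡2⇒%6≡5 n n≡1 n≡2
    where
    VS≡S : V S ≗ S
    VS≡S v = trans (V-on-kernel S∈K v) (cong (_xor S v) (HS≡𝟘 v))
    n≡1 : n % 2 ≡ 1
    n≡1 = decidable-stable (n % 2 ≟ 1) (λ n≢1 → S≢𝟘 (V-fixes⇒𝟘 n≢1 VS≡S))
    n≡2 : n % 3 ≡ 2
    n≡2 = decidable-stable (n % 3 ≟ 2) (λ n≢2 → S≢𝟘 (H-annihilates⇒𝟘 n≢2 HS≡𝟘))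

  H-fixes⇒n%6≡5 : ∀ {S} → InKer S → H S ≗ S → ¬ S ≗ 𝟘 → n % 6 ≡ 5
  H-fixes⇒n%6≡5 {S} S∈K HS≡S S≢𝟘 =
    H-annihilates⇒n%6≡5 (InKer-transpose S∈K) HSᵀ≡𝟘 (λ Sᵀ≡𝟘 → S≢𝟘 λ { (i , j) → Sᵀ≡𝟘 (j , i) })
    where
    HSᵀ≡𝟘 : H (transpose S) ≗ 𝟘
    HSᵀ≡𝟘 (i , j) = trans (V-on-kernel S∈K (j , i))
      (trans (cong (_xor S (j , i)) (HS≡S (j , i))) (xor-same (S (j , i))))

-- Reflected tilings

-- τ folds ℕ onto the 4-path by reflections: 0 1 2 3 4 3 2 1 0 4 0 1 …, where the value 4
-- (at which pad vanishes) marks the zero lines between mirrored copies.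
τ : ℕ → ℕ
τ 0 = 0
τ 1 = 1
τ 2 = 2
τ 3 = 3
τ 4 = 4
τ 5 = 3
τ 6 = 2
τ 7 = 1
τ 8 = 0
τ 9 = 4
τ (suc (suc (suc (suc (suc (suc (suc (suc (suc (suc k)))))))))) = τ k

τ-toℕ : (l : Fin 4) → τ (toℕ l) ≡ toℕ l
τ-toℕ 0F = refl
τ-toℕ 1F = refl
τ-toℕ 2F = refl
τ-toℕ 3F = refl

τ-four : ∀ n → n % 5 ≡ 4 → τ n ≡ 4
τ-four 4 _ = refl
τ-four 9 _ = refl
τ-four (suc (suc (suc (suc (suc (suc (suc (suc (suc (suc k)))))))))) k≡4 =
  τ-four k (trans (sym (trans (cong (_% 5) (+-comm 10 k)) ([m+kn]%n≡m%n k 2 5))) k≡4)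

reflect : (Fin 4 → Bool) → ℕ → Bool
reflect f k = pad f (τ k)

-- At a zero line (J ≡ 4 or 9 mod 10) the two neighbours are mirror images and cancel.
pathN-reflect : ∀ f J → pathN (reflect f) J ≡ reflect (pathNᶠ f) J
pathN-reflect f 0 = refl
pathN-reflect f 1 = refl
pathN-reflect f 2 = refl
pathN-reflect f 3 = refl
pathN-reflect f 4 = xor-same (f 3F)
pathN-reflect f 5 = xor-swap-false (f 3F) (f 2F)
pathN-reflect f 6 = xor-reverse (f 3F) (f 2F) (f 1F)
pathN-reflect f 7 = xor-reverse (f 2F) (f 1F) (f 0F)
pathN-reflect f 8 = sym (xor-swap-false (f 0F) (f 1F))
pathN-reflect f 9 = xor-same (f 0F)
pathN-reflect f 10 = refl
pathN-reflect f (suc (suc (suc (suc (suc (suc (suc (suc (suc (suc (suc k))))))))))) = pathN-reflect f (suc k)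

module _ {n : ℕ} (τn≡4 : τ n ≡ 4) where

  pathNᶠ-reflect : ∀ f (j : Fin n) → pathNᶠ (λ l → reflect f (toℕ l)) j ≡ reflect (pathNᶠ f) (toℕ j)
  pathNᶠ-reflect f j = trans
    (pathN-local (toℕ j) (λ k k≤j+1 → pad-restrict (reflect f) (cong (pad f) τn≡4) (≤-trans k≤j+1 (toℕ<n j))))
    (pathN-reflect f (toℕ j))

  tile : Vect 4 → Vect n
  tile P (i , j) = reflect (λ l → reflect (λ k → P (k , l)) (toℕ i)) (toℕ j)

  tile-cong : ∀ {P Q} → P ≗ Q → tile P ≗ tile Q
  tile-cong P≗Q (i , j) = pad-cong (λ l → pad-cong (λ k → P≗Q (k , l)) (τ (toℕ i))) (τ (toℕ j))

  tile-𝟘 : tile 𝟘 ≗ 𝟘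
  tile-𝟘 (i , j) =
    trans (pad-cong {4} (λ l → pad-false {4} (τ (toℕ i))) (τ (toℕ j))) (pad-false {4} (τ (toℕ j)))

  tile-additive : ∀ P Q → tile (P +ᵛ Q) ≗ tile P +ᵛ tile Q
  tile-additive P Q (i , j) = trans
    (pad-cong (λ l → pad-xor (λ k → P (k , l)) (λ k → Q (k , l)) (τ (toℕ i))) (τ (toℕ j)))
    (pad-xor (λ l → reflect (λ k → P (k , l)) (toℕ i)) (λ l → reflect (λ k → Q (k , l)) (toℕ i)) (τ (toℕ j)))

  tile-transpose : ∀ P → tile (transpose P) ≗ transpose (tile P)
  tile-transpose P (i , j) = pad-swap (λ l k → P (l , k)) (τ (toℕ j)) (τ (toℕ i))

  H-tile : ∀ P → H (tile P) ≗ tile (H P)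
  H-tile P (i , j) = trans (H-row (tile P) i j) (trans (pathNᶠ-reflect g j) (pad-cong (λ l → begin
    pathN (pad g) (toℕ l)
      ≡⟨ pathN-local (toℕ l) (λ y _ → sym (pad-swap (λ k l' → P (k , l')) x y)) ⟩
    pathN (λ y → pad (λ k → pad (λ l' → P (k , l')) y) x) (toℕ l)
      ≡⟨ sym (pad-pathN (λ k → pad (λ l' → P (k , l'))) (toℕ l) x) ⟩
    pad (λ k → pathNᶠ (λ l' → P (k , l')) l) x
      ≡⟨ pad-cong (λ k → sym (H-row P k l)) x ⟩
    pad (λ k → H P (k , l)) x ∎) (τ (toℕ j))))
    where
    open ≡-Reasoning
    x : ℕ
    x = τ (toℕ i)
    g : Fin 4 → Bool
    g l = reflect (λ k → P (k , l)) (toℕ i)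

  V-tile : ∀ P → V (tile P) ≗ tile (V P)
  V-tile P (i , j) = begin
    H (transpose (tile P)) (j , i)   ≡⟨ rowwise-cong pathMatrix (λ v → sym (tile-transpose P v)) (j , i) ⟩
    H (tile (transpose P)) (j , i)   ≡⟨ H-tile (transpose P) (j , i) ⟩
    tile (transpose (V P)) (j , i)   ≡⟨ tile-transpose (V P) (j , i) ⟩
    tile (V P) (i , j)               ∎
    where open ≡-Reasoning

  InKer-tile : ∀ {P} → InKer P → InKer (tile P)
  InKer-tile {P} P∈K v = begin
    Φ (tile P) v                                   ≡⟨ Φ-decomposition (tile P) v ⟩
    H (tile P) v xor (V (tile P) v xor tile P v)   ≡⟨ cong₂ _xor_ (H-tile P v) (cong (_xor tile P v) (V-tile P v)) ⟩
    tile (H P) v xor (tile (V P) v xor tile P v)   ≡⟨ sym (cong (tile (H P) v xor_) (tile-additive (V P) P v)) ⟩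
    tile (H P) v xor tile (V P +ᵛ P) v             ≡⟨ sym (tile-additive (H P) (V P +ᵛ P) v) ⟩
    tile (H P +ᵛ (V P +ᵛ P)) v                     ≡⟨ tile-cong (λ u → sym (Φ-decomposition P u)) v ⟩
    tile (Φ P) v                                   ≡⟨ tile-cong P∈K v ⟩
    tile 𝟘 v                                       ≡⟨ tile-𝟘 v ⟩
    false                                          ∎
    where open ≡-Reasoning

  tile-at : ∀ P {i j} (k l : Fin 4) → toℕ i ≡ toℕ k → toℕ j ≡ toℕ l → tile P (i , j) ≡ P (k , l)
  tile-at P k l i≡k j≡l = trans
    (cong₂ (λ a b → pad (λ l' → pad (λ k' → P (k' , l')) a) b)
           (trans (cong τ i≡k) (τ-toℕ k)) (trans (cong τ j≡l) (τ-toℕ l)))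
    (trans (pad-toℕ (λ l' → pad (λ k' → P (k' , l')) (toℕ k)) l) (pad-toℕ (λ k' → P (k' , l)) k))

fromRows : Vec (Vec ℕ 4) 4 → Vect 4
fromRows rows (i , j) = lookup (lookup rows i) j ≡ᵇ 1

kernel₄ : Fin 3 → Vect 4
kernel₄ 0F = fromRows
  ( (1 ∷ 0 ∷ 0 ∷ 0 ∷ [])
  ∷ (1 ∷ 1 ∷ 0 ∷ 0 ∷ [])
  ∷ (1 ∷ 0 ∷ 1 ∷ 0 ∷ [])
  ∷ (0 ∷ 1 ∷ 1 ∷ 1 ∷ [])
  ∷ [])
kernel₄ 1F = fromRows
  ( (0 ∷ 1 ∷ 0 ∷ 0 ∷ [])
  ∷ (1 ∷ 1 ∷ 1 ∷ 0 ∷ [])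
  ∷ (0 ∷ 0 ∷ 0 ∷ 1 ∷ [])
  ∷ (1 ∷ 1 ∷ 0 ∷ 1 ∷ [])
  ∷ [])
kernel₄ 2F = fromRows
  ( (0 ∷ 0 ∷ 1 ∷ 0 ∷ [])
  ∷ (0 ∷ 1 ∷ 1 ∷ 1 ∷ [])
  ∷ (1 ∷ 0 ∷ 0 ∷ 0 ∷ [])
  ∷ (1 ∷ 0 ∷ 1 ∷ 1 ∷ [])
  ∷ [])

kernel₄-InKer : ∀ a → InKer (kernel₄ a)
kernel₄-InKer a (i , j) = from-yes (all? λ a → all? λ i → all? λ j → Φ (kernel₄ a) (i , j) Bool.≟ false) a i j

kernel₄-first-row : ∀ a l → kernel₄ a (0F , inject₁ l) ≡ (toℕ a ≡ᵇ toℕ l)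
kernel₄-first-row = from-yes (all? λ a → all? λ l → kernel₄ a (0F , inject₁ l) Bool.≟ (toℕ a ≡ᵇ toℕ l))

tiled-dual-triple : ∀ {n} → n % 5 ≡ 4 →
  Σ (Fin 3 → Vect n) λ S → Σ (Fin 3 → Cell n) λ v →
    (∀ a → InKer (S a)) × (∀ a a' → S a (v a') ≡ (toℕ a ≡ᵇ toℕ a'))
tiled-dual-triple {n} n≡4 = S , v , (λ a → InKer-tile τn≡4 (kernel₄-InKer a)) , δ
  where
  τn≡4 : τ n ≡ 4
  τn≡4 = τ-four n n≡4
  3≤n : 3 ≤ n
  3≤n = ≤-trans (n≤1+n 3) (subst (_≤ n) n≡4 (m%n≤m n 5))
  S : Fin 3 → Vect n
  S a = tile τn≡4 (kernel₄ a)
  v : Fin 3 → Cell n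
  v a' = inject≤ 0F 3≤n , inject≤ a' 3≤n
  δ : ∀ a a' → S a (v a') ≡ (toℕ a ≡ᵇ toℕ a')
  δ a a' = trans (tile-at τn≡4 (kernel₄ a) 0F (inject₁ a') (toℕ-inject≤ 0F 3≤n)
                   (trans (toℕ-inject≤ a' 3≤n) (sym (toℕ-inject₁ a'))))
                 (kernel₄-first-row a a')

-- Linear algebra in 𝔽₂² and coordinates in a two-dimensional kernel

Coord : Set
Coord = Bool × Bool

𝟎 e₀ : Coord
𝟎 = false , false
e₀ = true , false

infixl 6 _+ᶜ_
infixl 7 _·ᶜ_

_+ᶜ_ : Coord → Coord → Coord
(a , b) +ᶜ (c , d) = a xor c , b xor d

_·ᶜ_ : Bool → Coord → Coord
x ·ᶜ (a , b) = x ∧ a , x ∧ b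

-- A matrix is given by its columns, the images of e₀ and e₁.
Matrix : Set
Matrix = Coord × Coord

apply : Matrix → Coord → Coord
apply (m₀ , m₁) (x , y) = x ·ᶜ m₀ +ᶜ y ·ᶜ m₁

Singular HasFixedVector : Matrix → Set
Singular M = ∃ λ c → c ≢ 𝟎 × apply M c ≡ 𝟎
HasFixedVector M = ∃ λ c → c ≢ 𝟎 × apply M c ≡ c

matrix-trichotomy : ∀ M → Singular M ⊎ HasFixedVector M ⊎ apply M (apply M e₀) ≡ apply M e₀ +ᶜ e₀
matrix-trichotomy ((false , false) , _) = inj₁ (e₀ , (λ ()) , refl)
matrix-trichotomy ((true , false) , _) = inj₂ (inj₁ (e₀ , (λ ()) , refl))
matrix-trichotomy ((false , true) , (false , false)) = inj₁ ((false , true) , (λ ()) , refl)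
matrix-trichotomy ((false , true) , (false , true)) = inj₂ (inj₁ ((false , true) , (λ ()) , refl))
matrix-trichotomy ((false , true) , (true , false)) = inj₂ (inj₁ ((true , true) , (λ ()) , refl))
matrix-trichotomy ((false , true) , (true , true)) = inj₂ (inj₂ refl)
matrix-trichotomy ((true , true) , (false , false)) = inj₁ ((false , true) , (λ ()) , refl)
matrix-trichotomy ((true , true) , (false , true)) = inj₂ (inj₁ ((false , true) , (λ ()) , refl))
matrix-trichotomy ((true , true) , (true , false)) = inj₂ (inj₂ refl)
matrix-trichotomy ((true , true) , (true , true)) = inj₁ ((true , true) , (λ ()) , refl)

distinct-nonzero-sum : ∀ c₁ c₂ c₃ → c₁ ≢ 𝟎 → c₂ ≢ 𝟎 → c₃ ≢ 𝟎 → c₁ ≢ c₂ → c₁ ≢ c₃ → c₂ ≢ c₃ →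
  c₁ +ᶜ (c₂ +ᶜ c₃) ≡ 𝟎
distinct-nonzero-sum (false , false) _ _ z₁ _ _ _ _ _ = ⊥-elim (z₁ refl)
distinct-nonzero-sum _ (false , false) _ _ z₂ _ _ _ _ = ⊥-elim (z₂ refl)
distinct-nonzero-sum _ _ (false , false) _ _ z₃ _ _ _ = ⊥-elim (z₃ refl)
distinct-nonzero-sum (false , true) (false , true) _ _ _ _ d₁₂ _ _ = ⊥-elim (d₁₂ refl)
distinct-nonzero-sum (true , false) (true , false) _ _ _ _ d₁₂ _ _ = ⊥-elim (d₁₂ refl)
distinct-nonzero-sum (true , true) (true , true) _ _ _ _ d₁₂ _ _ = ⊥-elim (d₁₂ refl)
distinct-nonzero-sum (false , true) _ (false , true) _ _ _ _ d₁₃ _ = ⊥-elim (d₁₃ refl)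
distinct-nonzero-sum (true , false) _ (true , false) _ _ _ _ d₁₃ _ = ⊥-elim (d₁₃ refl)
distinct-nonzero-sum (true , true) _ (true , true) _ _ _ _ d₁₃ _ = ⊥-elim (d₁₃ refl)
distinct-nonzero-sum _ (false , true) (false , true) _ _ _ _ _ d₂₃ = ⊥-elim (d₂₃ refl)
distinct-nonzero-sum _ (true , false) (true , false) _ _ _ _ _ d₂₃ = ⊥-elim (d₂₃ refl)
distinct-nonzero-sum _ (true , true) (true , true) _ _ _ _ _ d₂₃ = ⊥-elim (d₂₃ refl)
distinct-nonzero-sum (false , true) (true , false) (true , true) _ _ _ _ _ _ = refl
distinct-nonzero-sum (false , true) (true , true) (true , false) _ _ _ _ _ _ = refl
distinct-nonzero-sum (true , false) (false , true) (true , true) _ _ _ _ _ _ = refl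
distinct-nonzero-sum (true , false) (true , true) (false , true) _ _ _ _ _ _ = refl
distinct-nonzero-sum (true , true) (false , true) (true , false) _ _ _ _ _ _ = refl
distinct-nonzero-sum (true , true) (true , false) (false , true) _ _ _ _ _ _ = refl

module Coordinates {n : ℕ} {b : Fin 2 → Vect n} (basis : IsKerBasis n 2 b) where

  b₀ b₁ : Vect n
  b₀ = b 0F
  b₁ = b 1F

  lc : Coord → Vect n
  lc (x , y) = x · b₀ +ᵛ y · b₁

  lc-InKer : ∀ c → InKer (lc c)
  lc-InKer (x , y) = InKer-linear x y (proj₁ basis 0F) (proj₁ basis 1F)

  coefficients : Coord → Fin 2 → Bool
  coefficients (x , y) 0F = x
  coefficients (x , y) 1F = y

  lincomb≗lc : ∀ c → lincomb b (coefficients c) ≗ lc c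
  lincomb≗lc (x , y) v = cong ((x ∧ b₀ v) xor_) (xor-identityʳ (y ∧ b₁ v))

  lc-injective : ∀ c → lc c ≗ 𝟘 → c ≡ 𝟎
  lc-injective c lc≗𝟘 = cong₂ _,_ (independent 0F) (independent 1F)
    where
    independent : ∀ t → coefficients c t ≡ false
    independent = proj₁ (proj₂ basis) (coefficients c) (λ v → trans (lincomb≗lc c v) (lc≗𝟘 v))

  lc-nonzero : ∀ {c} → c ≢ 𝟎 → ¬ lc c ≗ 𝟘
  lc-nonzero c≢𝟎 lc≗𝟘 = c≢𝟎 (lc-injective _ lc≗𝟘)

  coordinates : ∀ S → InKer S → ∃ λ c → S ≗ lc c
  coordinates S S∈K with proj₂ (proj₂ basis) S S∈K
  ... | c , S≗ = (c 0F , c 1F) , λ v → trans (S≗ v) (lincomb≗lc (c 0F , c 1F) v)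

  lc-linear : ∀ x c y c' → x · lc c +ᵛ y · lc c' ≗ lc (x ·ᶜ c +ᶜ y ·ᶜ c')
  lc-linear x (a , a') y (d , d') v = regroup x a a' y d d' (b₀ v) (b₁ v)
    where
    regroup : ∀ x a a' y d d' p q →
      (x ∧ ((a ∧ p) xor (a' ∧ q))) xor (y ∧ ((d ∧ p) xor (d' ∧ q)))
        ≡ (((x ∧ a) xor (y ∧ d)) ∧ p) xor (((x ∧ a') xor (y ∧ d')) ∧ q)
    regroup = solve-∀ 𝔽₂

  lc-+ : ∀ c c' → lc c +ᵛ lc c' ≗ lc (c +ᶜ c')
  lc-+ c c' = lc-linear true c true c'

  module _ {F : Vect n → Vect n} (F-linear : Linear F) (F-InKer : ∀ {S} → InKer S → InKer (F S)) where

    private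
      image₀ : ∃ λ c → F b₀ ≗ lc c
      image₀ = coordinates (F b₀) (F-InKer (proj₁ basis 0F))
      image₁ : ∃ λ c → F b₁ ≗ lc c
      image₁ = coordinates (F b₁) (F-InKer (proj₁ basis 1F))

    matrixOf : Matrix
    matrixOf = proj₁ image₀ , proj₁ image₁

    matrixOf-spec : ∀ c → F (lc c) ≗ lc (apply matrixOf c)
    matrixOf-spec (x , y) v = begin
      F (x · b₀ +ᵛ y · b₁) v
        ≡⟨ F-linear x b₀ y b₁ v ⟩
      (x · F b₀ +ᵛ y · F b₁) v
        ≡⟨ cong₂ (λ p q → (x ∧ p) xor (y ∧ q)) (proj₂ image₀ v) (proj₂ image₁ v) ⟩
      (x · lc (proj₁ image₀) +ᵛ y · lc (proj₁ image₁)) v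
        ≡⟨ lc-linear x (proj₁ image₀) y (proj₁ image₁) v ⟩
      lc (apply matrixOf (x , y)) v ∎
      where open ≡-Reasoning

  Hᴹ : Matrix
  Hᴹ = matrixOf {F = H} (rowwise-linear pathMatrix) (λ {S} → InKer-H {n} {S})

  H-lc : ∀ c → H (lc c) ≗ lc (apply Hᴹ c)
  H-lc = matrixOf-spec {F = H} (rowwise-linear pathMatrix) (λ {S} → InKer-H {n} {S})

  Hᴹ-singular⇒n%6≡5 : Singular Hᴹ → n % 6 ≡ 5
  Hᴹ-singular⇒n%6≡5 (c , c≢𝟎 , Mc≡𝟎) =
    H-annihilates⇒n%6≡5 (lc-InKer c) (λ v → trans (H-lc c v) (cong (λ c → lc c v) Mc≡𝟎)) (lc-nonzero c≢𝟎)

  Hᴹ-fixes⇒n%6≡5 : HasFixedVector Hᴹ → n % 6 ≡ 5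
  Hᴹ-fixes⇒n%6≡5 (c , c≢𝟎 , Mc≡c) =
    H-fixes⇒n%6≡5 (lc-InKer c) (λ v → trans (H-lc c v) (cong (λ c → lc c v) Mc≡c)) (lc-nonzero c≢𝟎)

  Hᴹ²e₀≢Hᴹe₀+e₀ : n % 5 ≢ 4 → apply Hᴹ (apply Hᴹ e₀) ≢ apply Hᴹ e₀ +ᶜ e₀
  Hᴹ²e₀≢Hᴹe₀+e₀ n≢4 M²e₀≡Me₀+e₀ = lc-nonzero {e₀} (λ ()) (H²+H+1-annihilates⇒𝟘 n≢4 λ v → begin
    H (H (lc e₀)) v                    ≡⟨ rowwise-cong pathMatrix (H-lc e₀) v ⟩
    H (lc (apply Hᴹ e₀)) v             ≡⟨ H-lc (apply Hᴹ e₀) v ⟩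
    lc (apply Hᴹ (apply Hᴹ e₀)) v      ≡⟨ cong (λ c → lc c v) M²e₀≡Me₀+e₀ ⟩
    lc (apply Hᴹ e₀ +ᶜ e₀) v           ≡⟨ sym (lc-+ (apply Hᴹ e₀) e₀ v) ⟩
    lc (apply Hᴹ e₀) v xor lc e₀ v     ≡⟨ cong (_xor lc e₀ v) (sym (H-lc e₀ v)) ⟩
    H (lc e₀) v xor lc e₀ v            ∎)
    where open ≡-Reasoning

  no-dual-triple : (S : Fin 3 → Vect n) (v : Fin 3 → Cell n) →
    (∀ a → InKer (S a)) → (∀ a a' → S a (v a') ≡ (toℕ a ≡ᵇ toℕ a')) → ⊥
  no-dual-triple S v S∈K δ = true≢false (begin
    true                                            ≡⟨ sym (cong₂ _xor_ (δ 0F 0F) (cong₂ _xor_ (δ 1F 0F) (δ 2F 0F))) ⟩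
    S 0F w xor (S 1F w xor S 2F w)                  ≡⟨ cong₂ _xor_ (S≗ 0F w) (cong₂ _xor_ (S≗ 1F w) (S≗ 2F w)) ⟩
    lc (c 0F) w xor (lc (c 1F) w xor lc (c 2F) w)   ≡⟨ cong (lc (c 0F) w xor_) (lc-+ (c 1F) (c 2F) w) ⟩
    lc (c 0F) w xor lc (c 1F +ᶜ c 2F) w             ≡⟨ lc-+ (c 0F) (c 1F +ᶜ c 2F) w ⟩
    lc (c 0F +ᶜ (c 1F +ᶜ c 2F)) w                   ≡⟨ cong (λ c → lc c w) sum≡𝟎 ⟩
    false                                           ∎)
    where
    open ≡-Reasoning
    true≢false : true ≢ false
    true≢false ()
    w : Cell n
    w = v 0F
    c : Fin 3 → Coord
    c a = proj₁ (coordinates (S a) (S∈K a))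
    S≗ : ∀ a → S a ≗ lc (c a)
    S≗ a = proj₂ (coordinates (S a) (S∈K a))
    nonzero : ∀ a u → S a u ≡ true → c a ≢ 𝟎
    nonzero a u Sau ca≡𝟎 = true≢false (trans (sym Sau) (trans (S≗ a u) (cong (λ c → lc c u) ca≡𝟎)))
    separated : ∀ a a' u → S a u ≡ true → S a' u ≡ false → c a ≢ c a'
    separated a a' u Sau Sa'u ca≡ca' = true≢false (trans (sym Sau)
      (trans (S≗ a u) (trans (cong (λ c → lc c u) ca≡ca') (trans (sym (S≗ a' u)) Sa'u))))
    sum≡𝟎 : c 0F +ᶜ (c 1F +ᶜ c 2F) ≡ 𝟎
    sum≡𝟎 = distinct-nonzero-sum (c 0F) (c 1F) (c 2F)
      (nonzero 0F (v 0F) (δ 0F 0F)) (nonzero 1F (v 1F) (δ 1F 1F)) (nonzero 2F (v 2F) (δ 2F 2F))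
      (separated 0F 1F (v 0F) (δ 0F 0F) (δ 1F 0F)) (separated 0F 2F (v 0F) (δ 0F 0F) (δ 2F 0F))
      (separated 1F 2F (v 1F) (δ 1F 1F) (δ 2F 1F))

theorem5 : (n : ℕ) → 1 ≤ n → KerDim n 2 → n % 6 ≡ 5
theorem5 n _ (_ , basis) =
  [ Hᴹ-singular⇒n%6≡5 , [ Hᴹ-fixes⇒n%6≡5 , ⊥-elim ∘ Hᴹ²e₀≢Hᴹe₀+e₀ n≢4 ] ] (matrix-trichotomy Hᴹ)
  where
  open Coordinates basis
  n≢4 : n % 5 ≢ 4
  n≢4 n≡4 = let S , v , S∈K , δ = tiled-dual-triple n≡4 in no-dual-triple S v S∈K δ
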